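{- Let $(\mathcal{L},\mathcal{R})$ be a weak factorization system on a finitely complete category $\mathcal{E}$ in which left maps are preserved by pullback along fibrations. Then the following are equivalent: (i) every left map between fibrations over a common base $\Gamma$ is substitution-stable in $\Gamma$; (ii) every map between fibrations over a common base $\Gamma$ has an $(\mathcal{L},\mathcal{R})$-factorization whose $\mathcal{L}$-factor is substitution-stable in $\Gamma$; (iii) for every fibration $p:X\to\Gamma$, the diagonal $\Delta_p:X\to X\times_\Gamma X$ has an $(\mathcal{L},\mathcal{R})$-factorization whose $\mathcal{L}$-factor is substitution-stable in $\Gamma$. Moreover, (i), (ii), (iii) remain equivalent when each is restricted to fibrant bases $\Gamma$.
   Context: Maps in $\mathcal{R}$ are called fibrations and maps in $\mathcal{L}$ left maps; an object $\Gamma$ is fibrant if $\Gamma\to 1$ is a fibration. A map between fibrations over a common base $\Gamma$ means a map $i:A\to B$ with $A\to\Gamma$, $B\to\Gamma$ fibrations and $i$ commuting over $\Gamma$. Such a map is substitution-stable in $\Gamma$ if for every $f:\Gamma'\to\Gamma$ its pullback $A\times_\Gamma\Gamma'\to B\times_\Gamma\Gamma'$ along $f$ is again a left map. -}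

module Defs where

open import Level using (Level; _⊔_; Lift) renaming (suc to lsuc)
open import Data.Product using (Σ; Σ-syntax; _×_; _,_)
open import Data.Unit using (⊤)
open import Relation.Binary using (IsEquivalence)

record Category (o ℓ e : Level) : Set (lsuc (o ⊔ ℓ ⊔ e)) where
  infixr 9 _∘_
  infix  4 _≈_
  field
    Obj      : Set o
    _⇒_      : Obj → Obj → Set ℓ
    _≈_      : ∀ {A B} → A ⇒ B → A ⇒ B → Set e
    id       : ∀ {A} → A ⇒ A
    _∘_      : ∀ {A B C} → B ⇒ C → A ⇒ B → A ⇒ C
    equiv    : ∀ {A B} → IsEquivalence (_≈_ {A} {B})
    ∘-resp-≈ : ∀ {A B C} {f h : B ⇒ C} {g i : A ⇒ B} → f ≈ h → g ≈ i → f ∘ g ≈ h ∘ i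
    assoc    : ∀ {A B C D} {f : A ⇒ B} {g : B ⇒ C} {h : C ⇒ D} → (h ∘ g) ∘ f ≈ h ∘ (g ∘ f)
    identityˡ : ∀ {A B} {f : A ⇒ B} → id ∘ f ≈ f
    identityʳ : ∀ {A B} {f : A ⇒ B} → f ∘ id ≈ f

module _ {o ℓ e : Level} (𝓔 : Category o ℓ e) where
  open Category 𝓔

  record Terminal : Set (o ⊔ ℓ ⊔ e) where
    field
      ⊤ₒ      : Obj
      !       : ∀ {A} → A ⇒ ⊤ₒ
      !-unique : ∀ {A} (f : A ⇒ ⊤ₒ) → ! ≈ f

  record Pullback {A B C : Obj} (f : A ⇒ C) (g : B ⇒ C) : Set (o ⊔ ℓ ⊔ e) where
    field
      P         : Obj
      p₁        : P ⇒ A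
      p₂        : P ⇒ B
      commute   : f ∘ p₁ ≈ g ∘ p₂
      universal : ∀ {X} {h₁ : X ⇒ A} {h₂ : X ⇒ B} → f ∘ h₁ ≈ g ∘ h₂ → X ⇒ P
      p₁∘universal≈h₁ : ∀ {X} {h₁ : X ⇒ A} {h₂ : X ⇒ B} (eq : f ∘ h₁ ≈ g ∘ h₂) →
                        p₁ ∘ universal eq ≈ h₁
      p₂∘universal≈h₂ : ∀ {X} {h₁ : X ⇒ A} {h₂ : X ⇒ B} (eq : f ∘ h₁ ≈ g ∘ h₂) →
                        p₂ ∘ universal eq ≈ h₂
      unique    : ∀ {X} {h₁ : X ⇒ A} {h₂ : X ⇒ B} (eq : f ∘ h₁ ≈ g ∘ h₂) (k : X ⇒ P) →
                  p₁ ∘ k ≈ h₁ → p₂ ∘ k ≈ h₂ → k ≈ universal eq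

  record FinitelyComplete : Set (o ⊔ ℓ ⊔ e) where
    field
      terminal : Terminal
      pullback : ∀ {A B C} (f : A ⇒ C) (g : B ⇒ C) → Pullback f g

  Lifts : ∀ {A B X Y} → A ⇒ B → X ⇒ Y → Set (ℓ ⊔ e)
  Lifts {A} {B} {X} {Y} i f =
    ∀ (u : A ⇒ X) (v : B ⇒ Y) → f ∘ u ≈ v ∘ i →
    Σ[ d ∈ B ⇒ X ] (d ∘ i ≈ u × f ∘ d ≈ v)

  record WFS (p : Level) : Set (lsuc p ⊔ o ⊔ ℓ ⊔ e) where
    field
      L : ∀ {A B} → A ⇒ B → Set p
      R : ∀ {A B} → A ⇒ B → Set p
      factor : ∀ {A B} (f : A ⇒ B) →
               Σ[ C ∈ Obj ] Σ[ l ∈ A ⇒ C ] Σ[ r ∈ C ⇒ B ] (L l × R r × r ∘ l ≈ f)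
      lift   : ∀ {A B X Y} {i : A ⇒ B} {f : X ⇒ Y} → L i → R f → Lifts i f
      L-from-lift : ∀ {A B} (i : A ⇒ B) → (∀ {X Y} (f : X ⇒ Y) → R f → Lifts i f) → L i
      R-from-lift : ∀ {X Y} (f : X ⇒ Y) → (∀ {A B} (i : A ⇒ B) → L i → Lifts i f) → R f

module Conditions {o ℓ e p : Level} (𝓔 : Category o ℓ e)
                  (fc : FinitelyComplete 𝓔) (W : WFS 𝓔 p) where
  open Category 𝓔
  open FinitelyComplete fc
  open Terminal terminal
  open WFS W
  open Pullback

  Fibrant : Obj → Set p
  Fibrant Γ = R (! {Γ})

  AnyBase : Obj → Set p
  AnyBase _ = Lift p ⊤

  LeftPullbackStable : Set (o ⊔ ℓ ⊔ p)
  LeftPullbackStable = ∀ {A B B'} (i : A ⇒ B) (q : B' ⇒ B) → L i → R q →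
                       L (p₂ (pullback i q))

  -- i : A → B over Γ (with pA : A → Γ, pB : B → Γ) is substitution-stable in Γ:
  -- for every f : Γ' → Γ, the induced map A ×_Γ Γ' → B ×_Γ Γ'
  -- (the unique map j with π₁ ∘ j ≈ i ∘ π₁ and π₂ ∘ j ≈ π₂) is a left map.
  SubstStable : ∀ {Γ A B} (pA : A ⇒ Γ) (pB : B ⇒ Γ) (i : A ⇒ B) → Set (o ⊔ ℓ ⊔ e ⊔ p)
  SubstStable {Γ} pA pB i =
    ∀ {Γ'} (f : Γ' ⇒ Γ) (j : P (pullback pA f) ⇒ P (pullback pB f)) →
    p₁ (pullback pB f) ∘ j ≈ i ∘ p₁ (pullback pA f) →
    p₂ (pullback pB f) ∘ j ≈ p₂ (pullback pA f) →
    L j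

  diagonal : ∀ {X Γ} (q : X ⇒ Γ) → X ⇒ P (pullback q q)
  diagonal q = universal (pullback q q) {h₁ = id} {h₂ = id} (IsEquivalence.refl equiv)

  CondI : (Obj → Set p) → Set (o ⊔ ℓ ⊔ e ⊔ p)
  CondI Base = ∀ {Γ A B} → Base Γ → (pA : A ⇒ Γ) (pB : B ⇒ Γ) → R pA → R pB →
               (i : A ⇒ B) → pB ∘ i ≈ pA → L i → SubstStable pA pB i

  CondII : (Obj → Set p) → Set (o ⊔ ℓ ⊔ e ⊔ p)
  CondII Base = ∀ {Γ A B} → Base Γ → (pA : A ⇒ Γ) (pB : B ⇒ Γ) → R pA → R pB →
                (i : A ⇒ B) → pB ∘ i ≈ pA →
                Σ[ C ∈ Obj ] Σ[ l ∈ A ⇒ C ] Σ[ r ∈ C ⇒ B ]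
                  (L l × R r × r ∘ l ≈ i × SubstStable pA (pB ∘ r) l)

  CondIII : (Obj → Set p) → Set (o ⊔ ℓ ⊔ e ⊔ p)
  CondIII Base = ∀ {Γ X} → Base Γ → (q : X ⇒ Γ) → R q →
                 Σ[ C ∈ Obj ] Σ[ l ∈ X ⇒ C ] Σ[ r ∈ C ⇒ P (pullback q q) ]
                   (L l × R r × r ∘ l ≈ diagonal q ×
                    SubstStable q ((q ∘ p₁ (pullback q q)) ∘ r) l)

  TFAE : (Obj → Set p) → Set (o ⊔ ℓ ⊔ e ⊔ p)
  TFAE Base = (CondI Base → CondII Base) × (CondII Base → CondIII Base) ×
              (CondIII Base → CondI Base)

-- (i) ⇒ (ii): factor the map; the L-factor is again a left map between fibrations.
-- (ii) ⇒ (iii): the diagonal Δ_q is a map between the fibrations X and X ×_Γ X.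
-- (iii) ⇒ (i): a left map i : A → B between fibrations over Γ has a retraction r over Γ
-- (lift i against A → Γ), and lifting i against the path-object fibration C → B ×_Γ B
-- gives a homotopy from id to i ∘ r that is constant on A. Reindexing along f : Γ' → Γ
-- preserves all of this, and by (iii) the reflexivity map B → C stays a left map. So f*i
-- is a strong deformation retract along a left path map, and such maps are left maps once
-- left maps are stable under pullback along fibrations.
-- No implication changes the base Γ, so the same proofs work for fibrant bases.

module Submission where

open import Defs
open import Data.Product using (_×_; _,_; Σ-syntax; proj₁; proj₂)
open import Level using (Level)
open import Relation.Binary using (IsEquivalence; Setoid)
import Relation.Binary.Reasoning.Setoid as SetoidReasoning

module CategoryProperties {o ℓ e : Level} (𝓔 : Category o ℓ e) where
  open Category 𝓔
  open Pullback

  ≈-refl : ∀ {A B} {f : A ⇒ B} → f ≈ f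
  ≈-refl = IsEquivalence.refl equiv

  ≈-sym : ∀ {A B} {f g : A ⇒ B} → f ≈ g → g ≈ f
  ≈-sym = IsEquivalence.sym equiv

  ≈-trans : ∀ {A B} {f g h : A ⇒ B} → f ≈ g → g ≈ h → f ≈ h
  ≈-trans = IsEquivalence.trans equiv

  hom-setoid : Obj → Obj → Setoid ℓ e
  hom-setoid A B = record { Carrier = A ⇒ B ; _≈_ = _≈_ ; isEquivalence = equiv }

  module HomReasoning {A B : Obj} = SetoidReasoning (hom-setoid A B)
  open HomReasoning public using (begin_; _∎; step-≈-⟩; step-≈-⟨)

  infixr 4 _⟩∘⟨_
  _⟩∘⟨_ : ∀ {A B C} {f h : B ⇒ C} {g i : A ⇒ B} → f ≈ h → g ≈ i → f ∘ g ≈ h ∘ i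
  _⟩∘⟨_ = ∘-resp-≈

  refl⟩∘⟨_ : ∀ {A B C} {f : B ⇒ C} {g i : A ⇒ B} → g ≈ i → f ∘ g ≈ f ∘ i
  refl⟩∘⟨ q = ∘-resp-≈ ≈-refl q

  _⟩∘⟨refl : ∀ {A B C} {f h : B ⇒ C} {g : A ⇒ B} → f ≈ h → f ∘ g ≈ h ∘ g
  q ⟩∘⟨refl = ∘-resp-≈ q ≈-refl

  sym-assoc : ∀ {A B C D} {f : A ⇒ B} {g : B ⇒ C} {h : C ⇒ D} → h ∘ (g ∘ f) ≈ (h ∘ g) ∘ f
  sym-assoc = ≈-sym assoc

  pullˡ : ∀ {A B C D} {a : C ⇒ D} {b : B ⇒ C} {c : B ⇒ D} {f : A ⇒ B} →
          a ∘ b ≈ c → a ∘ (b ∘ f) ≈ c ∘ f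
  pullˡ ab≈c = ≈-trans sym-assoc (ab≈c ⟩∘⟨refl)

  pullʳ : ∀ {A B C D} {a : A ⇒ B} {b : B ⇒ C} {c : A ⇒ C} {f : C ⇒ D} →
          b ∘ a ≈ c → (f ∘ b) ∘ a ≈ f ∘ c
  pullʳ ba≈c = ≈-trans assoc (refl⟩∘⟨ ba≈c)

  Pullback-ext : ∀ {A B C X} {f : A ⇒ C} {g : B ⇒ C} (pb : Pullback 𝓔 f g) {k k' : X ⇒ P pb} →
                 p₁ pb ∘ k ≈ p₁ pb ∘ k' → p₂ pb ∘ k ≈ p₂ pb ∘ k' → k ≈ k'
  Pullback-ext {f = f} {g} pb {k} {k'} p₁k≈p₁k' p₂k≈p₂k' =
    ≈-trans (unique pb square k p₁k≈p₁k' p₂k≈p₂k') (≈-sym (unique pb square k' ≈-refl ≈-refl))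
    where
    square : f ∘ (p₁ pb ∘ k') ≈ g ∘ (p₂ pb ∘ k')
    square = ≈-trans (pullˡ (commute pb)) assoc

  Pullback-ext-id : ∀ {A B C} {f : A ⇒ C} {g : B ⇒ C} (pb : Pullback 𝓔 f g) {k : P pb ⇒ P pb} →
                    p₁ pb ∘ k ≈ p₁ pb → p₂ pb ∘ k ≈ p₂ pb → k ≈ id
  Pullback-ext-id pb p₁k≈p₁ p₂k≈p₂ =
    Pullback-ext pb (≈-trans p₁k≈p₁ (≈-sym identityʳ)) (≈-trans p₂k≈p₂ (≈-sym identityʳ))

module WFSProperties {o ℓ e p : Level} (𝓔 : Category o ℓ e) (W : WFS 𝓔 p) where
  open Category 𝓔
  open WFS W
  open Pullback
  open CategoryProperties 𝓔

  L-resp-≈ : ∀ {A B} {f g : A ⇒ B} → f ≈ g → L f → L g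
  L-resp-≈ {f = f} {g} f≈g Lf = L-from-lift g λ h Rh u v h∘u≈v∘g →
    let (d , d∘f≈u , h∘d≈v) = lift Lf Rh u v (≈-trans h∘u≈v∘g (refl⟩∘⟨ ≈-sym f≈g))
    in d , ≈-trans (refl⟩∘⟨ ≈-sym f≈g) d∘f≈u , h∘d≈v

  R-∘ : ∀ {A B C} {f : A ⇒ B} {g : B ⇒ C} → R f → R g → R (g ∘ f)
  R-∘ {f = f} {g} Rf Rg = R-from-lift (g ∘ f) λ i Li u v g∘f∘u≈v∘i →
    let (d₁ , d₁∘i≈f∘u , g∘d₁≈v) = lift Li Rg (f ∘ u) v (≈-trans sym-assoc g∘f∘u≈v∘i)
        (d₂ , d₂∘i≈u , f∘d₂≈d₁) = lift Li Rf u d₁ (≈-sym d₁∘i≈f∘u)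
    in d₂ , d₂∘i≈u , ≈-trans (pullʳ f∘d₂≈d₁) g∘d₁≈v

  R-pullback : ∀ {A B C} {h : A ⇒ C} {g : B ⇒ C} (pb : Pullback 𝓔 h g) → R g → R (p₁ pb)
  R-pullback {h = h} {g} pb Rg = R-from-lift (p₁ pb) λ i Li u v p₁∘u≈v∘i →
    let square = begin
          g ∘ (p₂ pb ∘ u)   ≈⟨ pullˡ (≈-sym (commute pb)) ⟩
          (h ∘ p₁ pb) ∘ u   ≈⟨ pullʳ p₁∘u≈v∘i ⟩
          h ∘ (v ∘ i)       ≈⟨ sym-assoc ⟩
          (h ∘ v) ∘ i       ∎
        (d , d∘i≈p₂∘u , g∘d≈h∘v) = lift Li Rg (p₂ pb ∘ u) (h ∘ v) square
        h∘v≈g∘d = ≈-sym g∘d≈h∘v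
        d̂∘i≈u = Pullback-ext pb
          (≈-trans (pullˡ (p₁∘universal≈h₁ pb h∘v≈g∘d)) (≈-sym p₁∘u≈v∘i))
          (≈-trans (pullˡ (p₂∘universal≈h₂ pb h∘v≈g∘d)) d∘i≈p₂∘u)
    in universal pb h∘v≈g∘d , d̂∘i≈u , p₁∘universal≈h₁ pb h∘v≈g∘d

module Reindexing {o ℓ e : Level} (𝓔 : Category o ℓ e) (fc : FinitelyComplete 𝓔)
                  {Γ Γ' : Category.Obj 𝓔} (f : Category._⇒_ 𝓔 Γ' Γ) where
  open Category 𝓔
  open FinitelyComplete fc
  open Pullback
  open CategoryProperties 𝓔

  reindex : ∀ {X Y} {pX : X ⇒ Γ} {pY : Y ⇒ Γ} (h : X ⇒ Y) → pY ∘ h ≈ pX →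
            P (pullback pX f) ⇒ P (pullback pY f)
  reindex {pX = pX} h over = universal (pullback _ f) (≈-trans (pullˡ over) (commute (pullback pX f)))

  module _ {X Y} {pX : X ⇒ Γ} {pY : Y ⇒ Γ} {h : X ⇒ Y} {over : pY ∘ h ≈ pX} where
    p₁∘reindex : p₁ (pullback pY f) ∘ reindex h over ≈ h ∘ p₁ (pullback pX f)
    p₁∘reindex = p₁∘universal≈h₁ (pullback pY f) _

    p₂∘reindex : p₂ (pullback pY f) ∘ reindex h over ≈ p₂ (pullback pX f)
    p₂∘reindex = p₂∘universal≈h₂ (pullback pY f) _

    reindex-unique : ∀ {j} → p₁ (pullback pY f) ∘ j ≈ h ∘ p₁ (pullback pX f) →
                     p₂ (pullback pY f) ∘ j ≈ p₂ (pullback pX f) → j ≈ reindex h over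
    reindex-unique p₁j p₂j =
      Pullback-ext (pullback pY f) (≈-trans p₁j (≈-sym p₁∘reindex)) (≈-trans p₂j (≈-sym p₂∘reindex))

  p₁∘reindex-∘ : ∀ {X Y Z} {pX : X ⇒ Γ} {pY : Y ⇒ Γ} {pZ : Z ⇒ Γ} {h : X ⇒ Y} {k : Y ⇒ Z}
                 {oh : pY ∘ h ≈ pX} {ok : pZ ∘ k ≈ pY} →
                 p₁ (pullback pZ f) ∘ (reindex k ok ∘ reindex h oh) ≈ (k ∘ h) ∘ p₁ (pullback pX f)
  p₁∘reindex-∘ {pX = pX} {pY} {pZ} {h} {k} {oh} {ok} = begin
    p₁ PZ ∘ (reindex k ok ∘ reindex h oh)  ≈⟨ pullˡ p₁∘reindex ⟩
    (k ∘ p₁ PY) ∘ reindex h oh             ≈⟨ pullʳ p₁∘reindex ⟩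
    k ∘ (h ∘ p₁ PX)                        ≈⟨ sym-assoc ⟩
    (k ∘ h) ∘ p₁ PX                        ∎
    where
    PX = pullback pX f
    PY = pullback pY f
    PZ = pullback pZ f

  p₂∘reindex-∘ : ∀ {X Y Z} {pX : X ⇒ Γ} {pY : Y ⇒ Γ} {pZ : Z ⇒ Γ} {h : X ⇒ Y} {k : Y ⇒ Z}
                 {oh : pY ∘ h ≈ pX} {ok : pZ ∘ k ≈ pY} →
                 p₂ (pullback pZ f) ∘ (reindex k ok ∘ reindex h oh) ≈ p₂ (pullback pX f)
  p₂∘reindex-∘ = ≈-trans (pullˡ p₂∘reindex) p₂∘reindex

  reindex-square : ∀ {X Y Y' Z} {pX : X ⇒ Γ} {pY : Y ⇒ Γ} {pY' : Y' ⇒ Γ} {pZ : Z ⇒ Γ}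
                   {h : X ⇒ Y} {k : Y ⇒ Z} {h' : X ⇒ Y'} {k' : Y' ⇒ Z}
                   {oh : pY ∘ h ≈ pX} {ok : pZ ∘ k ≈ pY} {oh' : pY' ∘ h' ≈ pX} {ok' : pZ ∘ k' ≈ pY'} →
                   k ∘ h ≈ k' ∘ h' → reindex k ok ∘ reindex h oh ≈ reindex k' ok' ∘ reindex h' oh'
  reindex-square {pZ = pZ} kh≈k'h' = Pullback-ext (pullback pZ f)
    (≈-trans p₁∘reindex-∘ (≈-trans (kh≈k'h' ⟩∘⟨refl) (≈-sym p₁∘reindex-∘)))
    (≈-trans p₂∘reindex-∘ (≈-sym p₂∘reindex-∘))

  reindex-retract : ∀ {X Y} {pX : X ⇒ Γ} {pY : Y ⇒ Γ} {h : X ⇒ Y} {k : Y ⇒ X}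
                    {oh : pY ∘ h ≈ pX} {ok : pX ∘ k ≈ pY} →
                    k ∘ h ≈ id → reindex k ok ∘ reindex h oh ≈ id
  reindex-retract {pX = pX} kh≈id = Pullback-ext-id (pullback pX f)
    (≈-trans p₁∘reindex-∘ (≈-trans (kh≈id ⟩∘⟨refl) identityˡ)) p₂∘reindex-∘

module _ {o ℓ e p : Level} (𝓔 : Category o ℓ e) (fc : FinitelyComplete 𝓔) (W : WFS 𝓔 p)
         (left-pullback-stable : Conditions.LeftPullbackStable 𝓔 fc W) where
  open Category 𝓔
  open FinitelyComplete fc
  open WFS W
  open Pullback
  open Conditions 𝓔 fc W
  open CategoryProperties 𝓔
  open WFSProperties 𝓔 W

  -- C is a path object for B with reflexivity map ρ and endpoints s, t; h is a homotopy
  -- from id to j ∘ r, constant on A.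
  L-strong-deformation-retract :
    ∀ {A B C} (j : A ⇒ B) (r : B ⇒ A) (ρ : B ⇒ C) (s t : C ⇒ B) (h : B ⇒ C) →
    L ρ → s ∘ ρ ≈ t ∘ ρ → r ∘ j ≈ id → s ∘ h ≈ id → t ∘ h ≈ j ∘ r → h ∘ j ≈ ρ ∘ j → L j
  L-strong-deformation-retract {A} {B} j r ρ s t h Lρ sρ≈tρ rj≈id sh≈id th≈jr hj≈ρj =
    L-from-lift j lifts
    where
    -- The lifting problem against g is solved on the base change of ρ along the fibration
    -- K → C, into which h maps B; this base change is a left map by hypothesis.
    lifts : ∀ {X Y} (g : X ⇒ Y) → R g → Lifts 𝓔 j g
    lifts {X} g Rg u v gu≈vj = τ ∘ ⟨h,ur⟩ , lift∘j≈u , g∘lift≈v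
      where
      K : Pullback 𝓔 (v ∘ t) g
      K = pullback (v ∘ t) g

      Q : Pullback 𝓔 ρ (p₁ K)
      Q = pullback ρ (p₁ K)

      square : g ∘ (p₂ K ∘ p₂ Q) ≈ ((v ∘ s) ∘ p₁ K) ∘ p₂ Q
      square = begin
        g ∘ (p₂ K ∘ p₂ Q)          ≈⟨ pullˡ (≈-sym (commute K)) ⟩
        ((v ∘ t) ∘ p₁ K) ∘ p₂ Q    ≈⟨ assoc ⟩
        (v ∘ t) ∘ (p₁ K ∘ p₂ Q)    ≈⟨ refl⟩∘⟨ commute Q ⟨
        (v ∘ t) ∘ (ρ ∘ p₁ Q)       ≈⟨ assoc ⟩
        v ∘ (t ∘ (ρ ∘ p₁ Q))       ≈⟨ refl⟩∘⟨ pullˡ (≈-sym sρ≈tρ) ⟩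
        v ∘ ((s ∘ ρ) ∘ p₁ Q)       ≈⟨ refl⟩∘⟨ pullʳ (commute Q) ⟩
        v ∘ (s ∘ (p₁ K ∘ p₂ Q))    ≈⟨ sym-assoc ⟩
        (v ∘ s) ∘ (p₁ K ∘ p₂ Q)    ≈⟨ sym-assoc ⟩
        ((v ∘ s) ∘ p₁ K) ∘ p₂ Q    ∎

      diagonal-lift : Σ[ τ ∈ P K ⇒ X ] (τ ∘ p₂ Q ≈ p₂ K ∘ p₂ Q × g ∘ τ ≈ (v ∘ s) ∘ p₁ K)
      diagonal-lift = lift (left-pullback-stable ρ (p₁ K) Lρ (R-pullback K Rg)) Rg
                           (p₂ K ∘ p₂ Q) ((v ∘ s) ∘ p₁ K) square

      τ : P K ⇒ X
      τ = proj₁ diagonal-lift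

      vth≈gur : (v ∘ t) ∘ h ≈ g ∘ (u ∘ r)
      vth≈gur = begin
        (v ∘ t) ∘ h     ≈⟨ pullʳ th≈jr ⟩
        v ∘ (j ∘ r)     ≈⟨ sym-assoc ⟩
        (v ∘ j) ∘ r     ≈⟨ gu≈vj ⟩∘⟨refl ⟨
        (g ∘ u) ∘ r     ≈⟨ assoc ⟩
        g ∘ (u ∘ r)     ∎

      ⟨h,ur⟩ : B ⇒ P K
      ⟨h,ur⟩ = universal K vth≈gur

      ρj≈k₁⟨h,ur⟩j : ρ ∘ j ≈ p₁ K ∘ (⟨h,ur⟩ ∘ j)
      ρj≈k₁⟨h,ur⟩j = ≈-trans (≈-sym hj≈ρj) (≈-sym (pullˡ (p₁∘universal≈h₁ K vth≈gur)))

      ⟨j,⟨h,ur⟩j⟩ : A ⇒ P Q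
      ⟨j,⟨h,ur⟩j⟩ = universal Q ρj≈k₁⟨h,ur⟩j

      q₂∘⟨j,⟨h,ur⟩j⟩ : p₂ Q ∘ ⟨j,⟨h,ur⟩j⟩ ≈ ⟨h,ur⟩ ∘ j
      q₂∘⟨j,⟨h,ur⟩j⟩ = p₂∘universal≈h₂ Q ρj≈k₁⟨h,ur⟩j

      lift∘j≈u : (τ ∘ ⟨h,ur⟩) ∘ j ≈ u
      lift∘j≈u = begin
        (τ ∘ ⟨h,ur⟩) ∘ j                 ≈⟨ assoc ⟩
        τ ∘ (⟨h,ur⟩ ∘ j)                 ≈⟨ refl⟩∘⟨ q₂∘⟨j,⟨h,ur⟩j⟩ ⟨
        τ ∘ (p₂ Q ∘ ⟨j,⟨h,ur⟩j⟩)          ≈⟨ pullˡ (proj₁ (proj₂ diagonal-lift)) ⟩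
        (p₂ K ∘ p₂ Q) ∘ ⟨j,⟨h,ur⟩j⟩       ≈⟨ pullʳ q₂∘⟨j,⟨h,ur⟩j⟩ ⟩
        p₂ K ∘ (⟨h,ur⟩ ∘ j)              ≈⟨ pullˡ (p₂∘universal≈h₂ K vth≈gur) ⟩
        (u ∘ r) ∘ j                      ≈⟨ pullʳ rj≈id ⟩
        u ∘ id                           ≈⟨ identityʳ ⟩
        u                                ∎

      g∘lift≈v : g ∘ (τ ∘ ⟨h,ur⟩) ≈ v
      g∘lift≈v = begin
        g ∘ (τ ∘ ⟨h,ur⟩)          ≈⟨ pullˡ (proj₂ (proj₂ diagonal-lift)) ⟩
        ((v ∘ s) ∘ p₁ K) ∘ ⟨h,ur⟩ ≈⟨ pullʳ (p₁∘universal≈h₁ K vth≈gur) ⟩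
        (v ∘ s) ∘ h               ≈⟨ pullʳ sh≈id ⟩
        v ∘ id                    ≈⟨ identityʳ ⟩
        v                         ∎

  module PathObjectHomotopy
    {Γ A B C} (pA : A ⇒ Γ) (pB : B ⇒ Γ) (RpA : R pA) (i : A ⇒ B) (pBi≈pA : pB ∘ i ≈ pA) (Li : L i)
    (l : B ⇒ C) (c : C ⇒ P (pullback pB pB)) (Rc : R c) (cl≈Δ : c ∘ l ≈ diagonal pB) where

    D : Pullback 𝓔 pB pB
    D = pullback pB pB

    d₁ d₂ : P D ⇒ B
    d₁ = p₁ D
    d₂ = p₂ D

    pC : C ⇒ Γ
    pC = (pB ∘ d₁) ∘ c

    d₁cl≈id : (d₁ ∘ c) ∘ l ≈ id
    d₁cl≈id = ≈-trans (pullʳ cl≈Δ) (p₁∘universal≈h₁ D ≈-refl)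

    d₂cl≈id : (d₂ ∘ c) ∘ l ≈ id
    d₂cl≈id = ≈-trans (pullʳ cl≈Δ) (p₂∘universal≈h₂ D ≈-refl)

    private
      retraction : Σ[ r ∈ B ⇒ A ] (r ∘ i ≈ id × pA ∘ r ≈ pB)
      retraction = lift Li RpA id pB (≈-trans identityʳ (≈-sym pBi≈pA))

    r : B ⇒ A
    r = proj₁ retraction

    ri≈id : r ∘ i ≈ id
    ri≈id = proj₁ (proj₂ retraction)

    pAr≈pB : pA ∘ r ≈ pB
    pAr≈pB = proj₂ (proj₂ retraction)

    pB≈pBir : pB ∘ id ≈ pB ∘ (i ∘ r)
    pB≈pBir = begin
      pB ∘ id         ≈⟨ identityʳ ⟩
      pB              ≈⟨ pAr≈pB ⟨
      pA ∘ r          ≈⟨ pBi≈pA ⟩∘⟨refl ⟨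
      (pB ∘ i) ∘ r    ≈⟨ assoc ⟩
      pB ∘ (i ∘ r)    ∎

    ⟨id,ir⟩ : B ⇒ P D
    ⟨id,ir⟩ = universal D pB≈pBir

    cli≈⟨id,ir⟩i : c ∘ (l ∘ i) ≈ ⟨id,ir⟩ ∘ i
    cli≈⟨id,ir⟩i = Pullback-ext D
      (≈-trans (through-cl d₁cl≈id)
               (≈-sym (≈-trans (pullˡ (p₁∘universal≈h₁ D pB≈pBir)) identityˡ)))
      (≈-trans (through-cl d₂cl≈id)
               (≈-sym (≈-trans (pullˡ (p₂∘universal≈h₂ D pB≈pBir))
                               (≈-trans (pullʳ ri≈id) identityʳ))))
      where
      through-cl : ∀ {d : P D ⇒ B} → (d ∘ c) ∘ l ≈ id → d ∘ (c ∘ (l ∘ i)) ≈ i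
      through-cl dcl≈id = ≈-trans sym-assoc (≈-trans (pullˡ dcl≈id) identityˡ)

    private
      homotopy : Σ[ H ∈ B ⇒ C ] (H ∘ i ≈ l ∘ i × c ∘ H ≈ ⟨id,ir⟩)
      homotopy = lift Li Rc (l ∘ i) ⟨id,ir⟩ cli≈⟨id,ir⟩i

    H : B ⇒ C
    H = proj₁ homotopy

    Hi≈li : H ∘ i ≈ l ∘ i
    Hi≈li = proj₁ (proj₂ homotopy)

    d₁cH≈id : (d₁ ∘ c) ∘ H ≈ id
    d₁cH≈id = ≈-trans (pullʳ (proj₂ (proj₂ homotopy))) (p₁∘universal≈h₁ D pB≈pBir)

    d₂cH≈ir : (d₂ ∘ c) ∘ H ≈ i ∘ r
    d₂cH≈ir = ≈-trans (pullʳ (proj₂ (proj₂ homotopy))) (p₂∘universal≈h₂ D pB≈pBir)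

    over-pC : ∀ {x : B ⇒ C} → (d₁ ∘ c) ∘ x ≈ id → pC ∘ x ≈ pB
    over-pC d₁cx≈id = ≈-trans (assoc ⟩∘⟨refl) (≈-trans (pullʳ d₁cx≈id) identityʳ)

    pBd₂c≈pC : pB ∘ (d₂ ∘ c) ≈ pC
    pBd₂c≈pC = ≈-trans sym-assoc (≈-sym (commute D) ⟩∘⟨refl)

    substitution-stable : SubstStable pB pC l → SubstStable pA pB i
    substitution-stable l-stable f j p₁j≈ip₁ p₂j≈p₂ =
      L-resp-≈ (≈-sym (reindex-unique p₁j≈ip₁ p₂j≈p₂))
        (L-strong-deformation-retract
          (reindex i pBi≈pA) (reindex r pAr≈pB) (reindex l (over-pC d₁cl≈id))
          (reindex (d₁ ∘ c) sym-assoc) (reindex (d₂ ∘ c) pBd₂c≈pC) (reindex H (over-pC d₁cH≈id))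
          (l-stable f _ p₁∘reindex p₂∘reindex)
          (reindex-square (≈-trans d₁cl≈id (≈-sym d₂cl≈id)))
          (reindex-retract ri≈id) (reindex-retract d₁cH≈id)
          (reindex-square d₂cH≈ir) (reindex-square Hi≈li))
      where open Reindexing 𝓔 fc f

  module _ (Base : Obj → Set p) where

    i⇒ii : CondI Base → CondII Base
    i⇒ii condI b pA pB RpA RpB i pBi≈pA =
      let (C , l , r , Ll , Rr , rl≈i) = factor i
      in C , l , r , Ll , Rr , rl≈i ,
         condI b pA (pB ∘ r) RpA (R-∘ Rr RpB) l (≈-trans (pullʳ rl≈i) pBi≈pA) Ll

    ii⇒iii : CondII Base → CondIII Base
    ii⇒iii condII b q Rq =
      condII b q (q ∘ p₁ D) Rq (R-∘ (R-pullback D Rq) Rq) (diagonal q)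
        (≈-trans (pullʳ (p₁∘universal≈h₁ D ≈-refl)) identityʳ)
      where D = pullback q q

    iii⇒i : CondIII Base → CondI Base
    iii⇒i condIII b pA pB RpA RpB i pBi≈pA Li =
      let (_ , l , c , _ , Rc , cl≈Δ , l-stable) = condIII b pB RpB
      in PathObjectHomotopy.substitution-stable pA pB RpA i pBi≈pA Li l c Rc cl≈Δ l-stable

    tfae : TFAE Base
    tfae = i⇒ii , ii⇒iii , iii⇒i

lemma4p2p3 : ∀ {o ℓ e p} (𝓔 : Category o ℓ e) (fc : FinitelyComplete 𝓔) (W : WFS 𝓔 p) →
             Conditions.LeftPullbackStable 𝓔 fc W →
             Conditions.TFAE 𝓔 fc W (Conditions.AnyBase 𝓔 fc W) ×
             Conditions.TFAE 𝓔 fc W (Conditions.Fibrant 𝓔 fc W)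
lemma4p2p3 𝓔 fc W left-pullback-stable =
  tfae 𝓔 fc W left-pullback-stable (Conditions.AnyBase 𝓔 fc W) ,
  tfae 𝓔 fc W left-pullback-stable (Conditions.Fibrant 𝓔 fc W)
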